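{- Let $G=(V,E)$ be a finite simple graph and $S$ a zero forcing set of $G$. Then there exists a forcing chain $S'$ of $S$ such that $\mathbf{q}^{S}(t)=\mathbf{q}^{S'}(t)$, i.e., $\mathbf{q}^{S'}_i(t)=\mathbf{q}^S_i(t)$ for every $i\in V$.
   Context: Zero forcing: starting with the vertices of $S$ colored, if a colored vertex $u$ has exactly one uncolored neighbor $v$, then $u$ may force $v$; $S$ is a zero forcing set if repeated forcing colors all vertices. A forcing chain $S'$ of $S$ is a record of a valid forcing process from $S$ coloring all of $V$: a sequence of forces $u\to v$, each valid at the time performed, in which each vertex of $V\setminus S$ is forced exactly once. $N[i]$ is the closed neighborhood of $i$. The error polynomial vector of $S'$ is defined recursively by $\mathbf{q}^{S'}_k(t)=1$ if $k\in S$ and $\mathbf{q}^{S'}_k(t)=t\sum_{j\in N[i]\setminus\{k\}}\mathbf{q}^{S'}_j(t)$ if $i$ forces $k$ in $S'$. For real polynomials, $p\preceq r$ means $p(t)\le r(t)$ for all sufficiently large real $t$. The error polynomial vector of $S$ is defined entrywise by $\mathbf{q}^S_i(t)=\min_{S'}\mathbf{q}^{S'}_i(t)$, the minimum under $\preceq$ over all forcing chains $S'$ of $S$. -}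

module Defs where

open import Data.Nat using (ℕ; zero; suc; _+_; _*_; _≤_)
open import Data.Fin using (Fin; _≟_)
open import Data.Bool using (Bool; true; false; if_then_else_; _∨_; _∧_; not)
open import Data.List using (List; []; _∷_; map; allFin)
open import Data.Nat.ListAction using (sum)
open import Data.Product using (Σ; _×_; _,_; ∃-syntax)
open import Relation.Binary.PropositionalEquality using (_≡_)
open import Relation.Nullary.Decidable using (⌊_⌋)

record SimpleGraph (n : ℕ) : Set where
  field
    Adj   : Fin n → Fin n → Bool
    sym   : ∀ u v → Adj u v ≡ Adj v u
    irrefl : ∀ v → Adj v v ≡ false
open SimpleGraph public

VSet : ℕ → Set
VSet n = Fin n → Bool

insert : ∀ {n} → Fin n → VSet n → VSet n
insert v c w = if ⌊ w ≟ v ⌋ then true else c w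

Force : ℕ → Set
Force n = Fin n × Fin n

ValidFrom : ∀ {n} → SimpleGraph n → VSet n → List (Force n) → Set
ValidFrom G c [] = ∀ v → c v ≡ true
ValidFrom G c ((u , v) ∷ F) =
  c u ≡ true × c v ≡ false × Adj G u v ≡ true
  × (∀ w → Adj G u w ≡ true → c w ≡ false → w ≡ v)
  × ValidFrom G (insert v c) F

-- S' is a forcing chain of S.  (That each vertex of V \ S is forced exactly
-- once follows: forced vertices must be uncoloured, and all end coloured.)
ForcingChain : ∀ {n} → SimpleGraph n → VSet n → List (Force n) → Set
ForcingChain G S F = ValidFrom G S F

IsZeroForcingSet : ∀ {n} → SimpleGraph n → VSet n → Set
IsZeroForcingSet G S = ∃[ F ] ForcingChain G S F

inClosedNbhd : ∀ {n} → SimpleGraph n → Fin n → Fin n → Bool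
inClosedNbhd G i j = ⌊ j ≟ i ⌋ ∨ Adj G i j

-- Polynomials are represented by their evaluation functions ℕ → ℕ
-- (all error polynomials have nonnegative integer coefficients).
-- errAux G t val F : processes forces in order; on i → k sets
--   val k := t * Σ_{j ∈ N[i] \ {k}} val j .
errAux : ∀ {n} → SimpleGraph n → ℕ → (Fin n → ℕ) → List (Force n) → Fin n → ℕ
errAux G t val [] = val
errAux {n} G t val ((i , k) ∷ F) = errAux G t val' F
  where
  term : Fin n → ℕ
  term j = if inClosedNbhd G i j ∧ not ⌊ j ≟ k ⌋ then val j else 0
  val' : Fin n → ℕ
  val' w = if ⌊ w ≟ k ⌋ then t * sum (map term (allFin n)) else val w

errPoly : ∀ {n} → SimpleGraph n → VSet n → List (Force n) → Fin n → ℕ → ℕ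
errPoly G S F k t = errAux G t (λ w → if S w then 1 else 0) F k

_⪯_ : (ℕ → ℕ) → (ℕ → ℕ) → Set
p ⪯ r = ∃[ N ] (∀ t → N ≤ t → p t ≤ r t)

IsErrPolyOfSet : ∀ {n} → SimpleGraph n → VSet n → Fin n → (ℕ → ℕ) → Set
IsErrPolyOfSet G S i p =
  (∃[ F ] (ForcingChain G S F × (∀ t → p t ≡ errPoly G S F i t)))
  × (∀ F → ForcingChain G S F → p ⪯ errPoly G S F i)

-- Build a forcing chain greedily: as long as some vertex is uncoloured, perform a currently
-- valid force whose new error polynomial is ⪯-least among all valid forces; such a force
-- exists because polynomials with natural coefficients are totally ordered by ⪯.
-- Say the greedy step at colour set c produced the polynomial m. Then in every forcing chain
-- every vertex outside c gets a polynomial ⪰ m: if i forces k ∉ c and N[i] ∖ {k} ⊆ c, then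
-- i → k is valid at c, so the new polynomial is ⪰ m by the greedy choice (the recursion is
-- monotone, and inductively the polynomials along the chain dominate the greedy ones);
-- otherwise some j ∈ N[i] ∖ {k} outside c already carries a polynomial q_j ⪰ m, and the
-- new polynomial is ⪰ t·q_j ⪰ q_j. As every vertex outside S receives in the greedy chain
-- exactly the minimum of the step at which it is coloured, the greedy chain is optimal.
module Submission where

open import Defs
open import Data.Nat using (ℕ)
open import Data.Fin using (Fin)
open import Data.List using (List)
open import Data.Product using (Σ-syntax; _×_)

open import Data.Nat.Base using (suc; _+_; _*_; _≤_; _<_; _⊔_; z≤n; s≤s; s≤s⁻¹; NonZero)
open import Data.Nat.Properties
  using ( ≤-refl; ≤-reflexive; ≤-trans; <⇒≤; m⊔n≤o⇒m≤o; m⊔n≤o⇒n≤o; m≤n⇒m≤1+n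
        ; m≤m+n; m≤n+m; m≤n*m
        ; +-mono-≤; +-monoˡ-<; *-monoˡ-≤; *-monoʳ-≤; +-identityʳ; *-comm; *-distribʳ-+; <-cmp
        ; +-commutativeSemigroup; module ≤-Reasoning )
open import Algebra.Properties.CommutativeSemigroup +-commutativeSemigroup using (interchange)
open import Data.Fin.Properties using (_≟_; any?; all?)
open import Data.Bool.Base using (true; false; if_then_else_; _∧_; not)
open import Data.Bool.Properties using (not-¬; ¬-not; ∨-zeroʳ; ∧-zeroʳ)
  renaming (_≟_ to _≟ᵇ_)
open import Data.List.Base using ([]; _∷_; map; allFin; length; cartesianProduct)
open import Data.Nat.ListAction using (sum)
open import Data.List.Membership.Propositional using (_∈_)
open import Data.List.Membership.Propositional.Properties
  using (∈-allFin; ∈-cartesianProduct⁺; ∈-map⁺)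
open import Data.List.Relation.Unary.Any using (here; there)
open import Data.Product using (_,_; proj₁; proj₂; ∃₂; ∃-syntax)
open import Data.Sum.Base using (_⊎_; inj₁; inj₂)
import Data.Sum.Base as Sum
open import Data.Empty using (⊥-elim)
open import Level using (0ℓ)
open import Relation.Binary.Core using (Rel)
open import Relation.Binary.Definitions using (Reflexive; Transitive; Total; tri<; tri≈; tri>)
open import Relation.Binary.PropositionalEquality
  using (_≡_; _≢_; refl; trans; cong; cong₂; subst; module ≡-Reasoning)
  renaming (sym to ≡-sym)
open import Relation.Nullary using (Dec; yes; no; contradiction)
open import Relation.Nullary.Decidable using (⌊_⌋; _×-dec_; _→-dec_)
open import Relation.Unary using (Pred; Decidable)

Eventually : (ℕ → Set) → Set
Eventually P = ∃[ N ] (∀ t → N ≤ t → P t)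

private
  variable
    A : Set
    P Q R : ℕ → Set
    f g h : ℕ → ℕ

always : (∀ t → P t) → Eventually P
always p = 0 , λ t _ → p t

eventually-map : (∀ {t} → P t → Q t) → Eventually P → Eventually Q
eventually-map f (N , p) = N , λ t N≤t → f (p t N≤t)

eventually-zip : (∀ {t} → P t → Q t → R t) → Eventually P → Eventually Q → Eventually R
eventually-zip f (M , p) (N , q) =
  M ⊔ N , λ t M⊔N≤t → f (p t (m⊔n≤o⇒m≤o M N M⊔N≤t)) (q t (m⊔n≤o⇒n≤o M N M⊔N≤t))

eventually-above : ∀ a → Eventually (a <_)
eventually-above a = suc a , λ _ a<t → a<t

⪯-reflexive : (∀ t → f t ≡ g t) → f ⪯ g
⪯-reflexive f≗g = always λ t → ≤-reflexive (f≗g t)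

⪯-refl : f ⪯ f
⪯-refl = ⪯-reflexive λ _ → refl

⪯-trans : f ⪯ g → g ⪯ h → f ⪯ h
⪯-trans = eventually-zip ≤-trans

*-monoʳ-⪯ : f ⪯ g → (λ t → t * f t) ⪯ (λ t → t * g t)
*-monoʳ-⪯ = eventually-map λ {t} → *-monoʳ-≤ t

if-then-0-mono-⪯ : ∀ b → (b ≡ true → f ⪯ g) →
  (λ t → if b then f t else 0) ⪯ (λ t → if b then g t else 0)
if-then-0-mono-⪯ true  f⪯g = f⪯g refl
if-then-0-mono-⪯ false _   = ⪯-refl

sum-mono-⪯ : (xs : List A) {f g : A → ℕ → ℕ} → (∀ a → f a ⪯ g a) →
  (λ t → sum (map (λ a → f a t) xs)) ⪯ (λ t → sum (map (λ a → g a t) xs))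
sum-mono-⪯ []       _   = ⪯-refl
sum-mono-⪯ (x ∷ xs) f⪯g = eventually-zip +-mono-≤ (f⪯g x) (sum-mono-⪯ xs f⪯g)

∈⇒≤sum : ∀ {n ns} → n ∈ ns → n ≤ sum ns
∈⇒≤sum {ns = n ∷ ns} (here refl)  = m≤m+n n (sum ns)
∈⇒≤sum {ns = m ∷ ns} (there n∈ns) = ≤-trans (∈⇒≤sum n∈ns) (m≤n+m (sum ns) m)

eval : List ℕ → ℕ → ℕ
eval []      t = 0
eval (a ∷ P) t = a + eval P t * t

IsPolynomial : (ℕ → ℕ) → Set
IsPolynomial f = ∃[ P ] (∀ t → f t ≡ eval P t)

infixl 6 _+ᴾ_
_+ᴾ_ : List ℕ → List ℕ → List ℕ
[]      +ᴾ R       = R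
(a ∷ P) +ᴾ []      = a ∷ P
(a ∷ P) +ᴾ (b ∷ R) = a + b ∷ P +ᴾ R

eval-+ᴾ : ∀ P R t → eval (P +ᴾ R) t ≡ eval P t + eval R t
eval-+ᴾ []      R       t = refl
eval-+ᴾ (a ∷ P) []      t = ≡-sym (+-identityʳ _)
eval-+ᴾ (a ∷ P) (b ∷ R) t = begin
  a + b + eval (P +ᴾ R) t * t           ≡⟨ cong (λ x → a + b + x * t) (eval-+ᴾ P R t) ⟩
  a + b + (eval P t + eval R t) * t     ≡⟨ cong (a + b +_) (*-distribʳ-+ t (eval P t) (eval R t)) ⟩
  a + b + (eval P t * t + eval R t * t) ≡⟨ interchange a b (eval P t * t) (eval R t * t) ⟩
  a + eval P t * t + (b + eval R t * t) ∎
  where open ≡-Reasoning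

polynomial-+ : IsPolynomial f → IsPolynomial g → IsPolynomial (λ t → f t + g t)
polynomial-+ (P , f≗P) (R , g≗R) =
  P +ᴾ R , λ t → trans (cong₂ _+_ (f≗P t) (g≗R t)) (≡-sym (eval-+ᴾ P R t))

polynomial-t* : IsPolynomial f → IsPolynomial (λ t → t * f t)
polynomial-t* (P , f≗P) = 0 ∷ P , λ t → trans (cong (t *_) (f≗P t)) (*-comm t (eval P t))

polynomial-if : ∀ b → IsPolynomial f → IsPolynomial g →
  IsPolynomial (λ t → if b then f t else g t)
polynomial-if true  f-poly _      = f-poly
polynomial-if false _      g-poly = g-poly

polynomial-const : ∀ a → IsPolynomial (λ _ → a)
polynomial-const a = a ∷ [] , λ _ → ≡-sym (+-identityʳ a)

polynomial-sum : (xs : List A) {f : A → ℕ → ℕ} → (∀ a → IsPolynomial (f a)) →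
  IsPolynomial (λ t → sum (map (λ a → f a t) xs))
polynomial-sum []       _      = polynomial-const 0
polynomial-sum (x ∷ xs) f-poly = polynomial-+ (f-poly x) (polynomial-sum xs f-poly)

Trichotomous : (ℕ → ℕ) → (ℕ → ℕ) → Set
Trichotomous f g =
  Eventually (λ t → f t < g t) ⊎ Eventually (λ t → f t ≡ g t) ⊎ Eventually (λ t → g t < f t)

+*-<-shift : ∀ a b {p r t} → a < t → p < r → a + p * t < b + r * t
+*-<-shift a b {p} {r} {t} a<t p<r = begin-strict
  a + p * t  <⟨ +-monoˡ-< (p * t) a<t ⟩
  suc p * t  ≤⟨ *-monoˡ-≤ t p<r ⟩
  r * t      ≤⟨ m≤n+m (r * t) b ⟩
  b + r * t  ∎
  where open ≤-Reasoning

trichotomous-shift : ∀ a b {p r} → Trichotomous p r →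
  Trichotomous (λ t → a + p t * t) (λ t → b + r t * t)
trichotomous-shift a b (inj₁ p<r) =
  inj₁ (eventually-zip (+*-<-shift a b) (eventually-above a) p<r)
trichotomous-shift a b (inj₂ (inj₂ r<p)) =
  inj₂ (inj₂ (eventually-zip (+*-<-shift b a) (eventually-above b) r<p))
trichotomous-shift a b {p} {r} (inj₂ (inj₁ p≡r)) with <-cmp a b
... | tri< a<b _ _ = inj₁ (eventually-map
  (λ {t} e → subst (λ x → a + p t * t < b + x * t) e (+-monoˡ-< (p t * t) a<b)) p≡r)
... | tri≈ _ refl _ = inj₂ (inj₁ (eventually-map (λ {t} e → cong (λ x → a + x * t) e) p≡r))
... | tri> _ _ b<a = inj₂ (inj₂ (eventually-map
  (λ {t} e → subst (λ x → b + r t * t < a + x * t) (≡-sym e) (+-monoˡ-< (r t * t) b<a)) p≡r))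

-- With the convention eval (a ∷ P) t = a + eval P t * t, the empty list evaluates
-- definitionally like 0 ∷ [], so one shift lemma covers all cases.
eval-trichotomous : ∀ P R → Trichotomous (eval P) (eval R)
eval-trichotomous []      []      = inj₂ (inj₁ (always λ _ → refl))
eval-trichotomous []      (b ∷ R) = trichotomous-shift 0 b (eval-trichotomous [] R)
eval-trichotomous (a ∷ P) []      = trichotomous-shift a 0 (eval-trichotomous P [])
eval-trichotomous (a ∷ P) (b ∷ R) = trichotomous-shift a b (eval-trichotomous P R)

eval-⪯-total : ∀ P R → eval P ⪯ eval R ⊎ eval R ⪯ eval P
eval-⪯-total P R with eval-trichotomous P R
... | inj₁ P<R        = inj₁ (eventually-map <⇒≤ P<R)
... | inj₂ (inj₁ P≡R) = inj₁ (eventually-map ≤-reflexive P≡R)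
... | inj₂ (inj₂ R<P) = inj₂ (eventually-map <⇒≤ R<P)

⪯-total : IsPolynomial f → IsPolynomial g → f ⪯ g ⊎ g ⪯ f
⪯-total {f = f} {g = g} (P , f≗P) (R , g≗R) =
  Sum.map (λ P⪯R → ⪯-trans f⪯P (⪯-trans P⪯R R⪯g))
          (λ R⪯P → ⪯-trans g⪯R (⪯-trans R⪯P P⪯f))
          (eval-⪯-total P R)
  where
  f⪯P : f ⪯ eval P
  f⪯P = ⪯-reflexive f≗P
  P⪯f : eval P ⪯ f
  P⪯f = ⪯-reflexive λ t → ≡-sym (f≗P t)
  g⪯R : g ⪯ eval R
  g⪯R = ⪯-reflexive g≗R
  R⪯g : eval R ⪯ g
  R⪯g = ⪯-reflexive λ t → ≡-sym (g≗R t)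

module _ (_≼_ : Rel A 0ℓ) (≼-refl : Reflexive _≼_) (≼-trans : Transitive _≼_)
         (≼-total : Total _≼_) {P : Pred A 0ℓ} (P? : Decidable P) where

  argmin : ∀ {a} → P a → (xs : List A) →
    ∃[ m ] (P m × m ≼ a × (∀ {x} → x ∈ xs → P x → m ≼ x))
  argmin pa [] = _ , pa , ≼-refl , λ ()
  argmin pa (x ∷ xs) with P? x
  ... | no ¬px with argmin pa xs
  ...   | m , pm , m≼a , m≼xs =
          m , pm , m≼a , λ { (here refl) px → contradiction px ¬px ; (there x∈xs) → m≼xs x∈xs }
  argmin {a} pa (x ∷ xs) | yes px with ≼-total a x
  ... | inj₁ a≼x with argmin pa xs
  ...   | m , pm , m≼a , m≼xs =
          m , pm , m≼a , λ { (here refl) _ → ≼-trans m≼a a≼x ; (there x∈xs) → m≼xs x∈xs }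
  argmin {a} pa (x ∷ xs) | yes px | inj₂ x≼a with argmin px xs
  ... | m , pm , m≼x , m≼xs =
        m , pm , ≼-trans m≼x x≼a , λ { (here refl) _ → m≼x ; (there x∈xs) → m≼xs x∈xs }

PolyVector : ℕ → Set
PolyVector n = Fin n → ℕ → ℕ

initial : ∀ {n} → VSet n → PolyVector n
initial S x _ = if S x then 1 else 0

initial-polynomial : ∀ {n} (S : VSet n) x → IsPolynomial (initial S x)
initial-polynomial S x = polynomial-if (S x) (polynomial-const 1) (polynomial-const 0)

module _ {n : ℕ} where

  infix 4 _⊆_
  _⊆_ : VSet n → VSet n → Set
  c ⊆ d = ∀ x → c x ≡ true → d x ≡ true

  ⊆-refl : ∀ {c} → c ⊆ c
  ⊆-refl _ cx = cx

  ⊆-trans : ∀ {c d e} → c ⊆ d → d ⊆ e → c ⊆ e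
  ⊆-trans c⊆d d⊆e x cx = d⊆e x (c⊆d x cx)

  ⊆-false : ∀ {c d x} → c ⊆ d → d x ≡ false → c x ≡ false
  ⊆-false {x = x} c⊆d dx = ¬-not λ cx → not-¬ (c⊆d x cx) dx

  ⊆-or-missing : ∀ (c d : VSet n) → c ⊆ d ⊎ ∃[ j ] (c j ≡ true × d j ≡ false)
  ⊆-or-missing c d with any? (λ j → (c j ≟ᵇ true) ×-dec (d j ≟ᵇ false))
  ... | yes missing = inj₂ missing
  ... | no  none    = inj₁ λ j cj → ¬-not λ dj → none (j , cj , dj)

  ≢-by-colour : ∀ {d : VSet n} {x v} → d x ≡ true → d v ≡ false → x ≢ v
  ≢-by-colour dx dv refl = not-¬ dx dv

  insert-≡ : ∀ {v} {c : VSet n} → insert v c v ≡ true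
  insert-≡ {v} with v ≟ v
  ... | yes _   = refl
  ... | no  v≢v = contradiction refl v≢v

  insert-≢ : ∀ {v} {c : VSet n} {x} → x ≢ v → insert v c x ≡ c x
  insert-≢ {v} {x = x} x≢v with x ≟ v
  ... | yes x≡v = contradiction x≡v x≢v
  ... | no  _   = refl

  ⊆-insert : ∀ {v} {c : VSet n} → c ⊆ insert v c
  ⊆-insert {v} x cx with x ≟ v
  ... | yes _ = refl
  ... | no  _ = cx

  insert-mono : ∀ {v} {c d : VSet n} → c ⊆ d → insert v c ⊆ insert v d
  insert-mono {v} c⊆d x cx with x ≟ v
  ... | yes _ = refl
  ... | no  _ = c⊆d x cx

  insert-⊆ : ∀ {v} {c d : VSet n} → d v ≡ true → c ⊆ d → insert v c ⊆ d
  insert-⊆ {v} dv c⊆d x cx with x ≟ v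
  ... | yes refl = dv
  ... | no  _    = c⊆d x cx

  insert-cancel : ∀ {v} {c d : VSet n} → c v ≡ false → insert v c ⊆ insert v d → c ⊆ d
  insert-cancel {v} {c} {d} cv ins⊆ins x cx =
    let x≢v = ≢-by-colour cx cv in
    trans (≡-sym (insert-≢ {v} {d} x≢v)) (ins⊆ins x (trans (insert-≢ {v} {c} x≢v) cx))

  module _ (G : SimpleGraph n) where

    Forces : VSet n → Fin n → Fin n → Set
    Forces c u v =
      c u ≡ true × c v ≡ false × Adj G u v ≡ true
      × (∀ w → Adj G u w ≡ true → c w ≡ false → w ≡ v)

    forces? : ∀ c u v → Dec (Forces c u v)
    forces? c u v = (c u ≟ᵇ true) ×-dec (c v ≟ᵇ false) ×-dec (Adj G u v ≟ᵇ true) ×-dec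
      all? λ w → (Adj G u w ≟ᵇ true) →-dec (c w ≟ᵇ false) →-dec (w ≟ v)

    ValidFrom-superset : ∀ F {c d} → ValidFrom G c F → c ⊆ d →
      ∃[ F′ ] (ValidFrom G d F′ × length F′ ≤ length F × (d ⊆ c ⊎ length F′ < length F))
    ValidFrom-superset [] all c⊆d = [] , (λ x → c⊆d x (all x)) , z≤n , inj₁ λ x _ → all x
    ValidFrom-superset ((i , k) ∷ F) {c} {d} (ci , ck , aik , unique , rest) c⊆d with d k in dk
    ... | true with ValidFrom-superset F rest (insert-⊆ dk c⊆d)
    ...   | F′ , valid , |F′|≤|F| , _ =
            F′ , valid , m≤n⇒m≤1+n |F′|≤|F| , inj₂ (s≤s |F′|≤|F|)
    ValidFrom-superset ((i , k) ∷ F) {c} {d} (ci , ck , aik , unique , rest) c⊆d | false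
      with ValidFrom-superset F rest (insert-mono c⊆d)
    ... | F′ , valid , |F′|≤|F| , d⊆c⊎shorter =
          (i , k) ∷ F′
          , (c⊆d i ci , dk , aik , (λ w aiw dw → unique w aiw (⊆-false c⊆d dw)) , valid)
          , s≤s |F′|≤|F|
          , Sum.map (insert-cancel dk) s≤s d⊆c⊎shorter

    ValidFrom-shrink : ∀ {c F v} → ValidFrom G c F → c v ≡ false →
      ∃[ F′ ] (ValidFrom G (insert v c) F′ × length F′ < length F)
    ValidFrom-shrink {c} {F} {v} valid cv with ValidFrom-superset F valid (⊆-insert {v} {c})
    ... | _  , _      , _ , inj₁ ins⊆c  = ⊥-elim (not-¬ (ins⊆c v (insert-≡ {v} {c})) cv)
    ... | F′ , valid′ , _ , inj₂ shorter = F′ , valid′ , shorter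

    -- Input i k is N[i] ∖ {k}, the index set of the sum in the recursion for i → k.
    Input : Fin n → Fin n → VSet n
    Input i k j = inClosedNbhd G i j ∧ not ⌊ j ≟ k ⌋

    Input-complete : ∀ {i k j} → (j ≡ i ⊎ Adj G i j ≡ true) → j ≢ k → Input i k j ≡ true
    Input-complete {i} {k} {j} j∈N[i] j≢k with j ≟ k
    ... | yes j≡k = contradiction j≡k j≢k
    ... | no  _ with j∈N[i]
    ...   | inj₂ aij rewrite aij | ∨-zeroʳ ⌊ j ≟ i ⌋ = refl
    ...   | inj₁ refl with j ≟ j
    ...     | yes _   = refl
    ...     | no  j≢j = contradiction refl j≢j

    Forces⇒Input⊆ : ∀ {c i k} → Forces c i k → Input i k ⊆ c
    Forces⇒Input⊆ {c} {i} {k} (ci , _ , _ , unique) j ij with j ≟ i | j ≟ k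
    ... | yes refl | _      = ci
    ... | no _     | yes refl = ⊥-elim (not-¬ ij (∧-zeroʳ _))
    ... | no _     | no j≢k with Adj G i j in aij | c j in cj
    ...   | false | _     = ⊥-elim (not-¬ ij refl)
    ...   | true  | true  = refl
    ...   | true  | false = ⊥-elim (j≢k (unique j aij cj))

    Input⊆⇒Forces : ∀ {c i k} → Adj G i k ≡ true → c k ≡ false → Input i k ⊆ c → Forces c i k
    Input⊆⇒Forces {c} {i} {k} aik ck Input⊆c =
      Input⊆c i (Input-complete (inj₁ refl) i≢k) , ck , aik , unique
      where
      i≢k : i ≢ k
      i≢k refl = not-¬ aik (irrefl G i)
      unique : ∀ w → Adj G i w ≡ true → c w ≡ false → w ≡ k
      unique w aiw cw with w ≟ k
      ... | yes w≡k = w≡k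
      ... | no  w≢k = ⊥-elim (not-¬ (Input⊆c w (Input-complete (inj₂ aiw) w≢k)) cw)

    forceValue : PolyVector n → Fin n → Fin n → ℕ → ℕ
    forceValue q i k t = t * sum (map (λ j → if Input i k j then q j t else 0) (allFin n))

    assign : PolyVector n → Fin n → Fin n → PolyVector n
    assign q i k x t = if ⌊ x ≟ k ⌋ then forceValue q i k t else q x t

    -- Unfolding errAux, errVector q ((i , k) ∷ F) is definitionally errVector (assign q i k) F,
    -- and errPoly G S F is definitionally errVector (initial S) F.
    errVector : PolyVector n → List (Force n) → PolyVector n
    errVector q F x t = errAux G t (λ y → q y t) F x

    assign-≡ : ∀ q i k t → assign q i k k t ≡ forceValue q i k t
    assign-≡ q i k t with k ≟ k
    ... | yes _   = refl
    ... | no  k≢k = contradiction refl k≢k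

    assign-≢ : ∀ q i k {x} → x ≢ k → ∀ t → assign q i k x t ≡ q x t
    assign-≢ q i k {x} x≢k t with x ≟ k
    ... | yes x≡k = contradiction x≡k x≢k
    ... | no  _   = refl

    errVector-coloured : ∀ {c F} q → ValidFrom G c F → ∀ {x} → c x ≡ true →
      ∀ t → errVector q F x t ≡ q x t
    errVector-coloured {F = []} q _ _ t = refl
    errVector-coloured {c} {(i , k) ∷ F} q (_ , ck , _ , _ , rest) {x} cx t =
      trans (errVector-coloured (assign q i k) rest (⊆-insert {k} {c} x cx) t)
            (assign-≢ q i k (≢-by-colour cx ck) t)

    forceValue-mono : ∀ {p q i k} → (∀ j → Input i k j ≡ true → p j ⪯ q j) →
      forceValue p i k ⪯ forceValue q i k
    forceValue-mono {i = i} {k} p⪯q =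
      *-monoʳ-⪯ (sum-mono-⪯ (allFin n) λ j → if-then-0-mono-⪯ (Input i k j) (p⪯q j))

    Input⇒⪯forceValue : ∀ {q i k j} → Input i k j ≡ true → q j ⪯ forceValue q i k
    Input⇒⪯forceValue {q} {i} {k} {j} ij = 1 , λ { (suc t) _ → bound (suc t) }
      where
      open ≤-Reasoning
      bound : ∀ t → .{{NonZero t}} → q j t ≤ forceValue q i k t
      bound t = let summand j′ = if Input i k j′ then q j′ t else 0 in begin
        q j t                         ≡⟨ cong (λ b → if b then q j t else 0) (≡-sym ij) ⟩
        summand j                     ≤⟨ ∈⇒≤sum (∈-map⁺ summand (∈-allFin j)) ⟩
        sum (map summand (allFin n))  ≤⟨ m≤n*m _ t ⟩
        forceValue q i k t            ∎

    forceValue-polynomial : ∀ {q} → (∀ x → IsPolynomial (q x)) → ∀ i k →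
      IsPolynomial (forceValue q i k)
    forceValue-polynomial {q} q-poly i k =
      polynomial-t* (polynomial-sum (allFin n) {λ j t → if Input i k j then q j t else 0} λ j →
        polynomial-if (Input i k j) (q-poly j) (polynomial-const 0))

    assign-polynomial : ∀ {q} → (∀ x → IsPolynomial (q x)) → ∀ i k x →
      IsPolynomial (assign q i k x)
    assign-polynomial q-poly i k x =
      polynomial-if ⌊ x ≟ k ⌋ (forceValue-polynomial q-poly i k) (q-poly x)

    cheapest-force : ∀ {c} q → (∀ x → IsPolynomial (q x)) → ∀ {i k} → Forces c i k →
      ∃₂ λ u v → Forces c u v × (∀ {i k} → Forces c i k → forceValue q u v ⪯ forceValue q i k)
    cheapest-force {c} q q-poly f
      with argmin _≼_ ⪯-refl ⪯-trans ≼-total (λ p → forces? c (proj₁ p) (proj₂ p)) f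
                  (cartesianProduct (allFin n) (allFin n))
      where
      _≼_ : Rel (Fin n × Fin n) 0ℓ
      (u , v) ≼ (i , k) = forceValue q u v ⪯ forceValue q i k
      ≼-total : Total _≼_
      ≼-total (u , v) (i , k) =
        ⪯-total (forceValue-polynomial q-poly u v) (forceValue-polynomial q-poly i k)
    ... | (u , v) , fuv , _ , least =
          u , v , fuv , λ {i} {k} → least (∈-cartesianProduct⁺ (∈-allFin i) (∈-allFin k))

    module _ (S : VSet n) where

      -- For the greedy polynomials g, each greedy step at colour set c with value m gives
      -- Threshold g c m, and a finished greedy chain gives Certified g S; Above is the
      -- invariant maintained along an arbitrary chain.
      Threshold : PolyVector n → VSet n → (ℕ → ℕ) → Set
      Threshold g c m = S ⊆ c × (∀ i k → Forces c i k → m ⪯ forceValue g i k)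

      Above : PolyVector n → Fin n → (ℕ → ℕ) → Set
      Above g x f = g x ⪯ f × (∀ c m → Threshold g c m → c x ≡ false → m ⪯ f)

      Certified : PolyVector n → VSet n → Set
      Certified g d =
        ∀ x → d x ≡ false → ∃[ c ] ∃[ m ] (Threshold g c m × c x ≡ false × g x ⪯ m)

      module _ {g : PolyVector n} (certified : Certified g S) where

        forced-above : ∀ {d i k q} → S ⊆ d → Forces d i k →
          (∀ {x} → d x ≡ true → Above g x (q x)) → Above g k (forceValue q i k)
        forced-above {i = i} {k} {q} S⊆d forces@(_ , dk , aik , _) above =
          g-below , thresholds-below
          where
          input-above : ∀ {j} → Input i k j ≡ true → Above g j (q j)
          input-above {j} ij = above (Forces⇒Input⊆ forces j ij)

          thresholds-below : ∀ c m → Threshold g c m → c k ≡ false → m ⪯ forceValue q i k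
          thresholds-below c m threshold@(_ , least) ck with ⊆-or-missing (Input i k) c
          ... | inj₁ Input⊆c = ⪯-trans (least i k (Input⊆⇒Forces aik ck Input⊆c))
                                        (forceValue-mono λ j ij → proj₁ (input-above ij))
          ... | inj₂ (j , ij , cj) = ⪯-trans (proj₂ (input-above ij) c m threshold cj)
                                              (Input⇒⪯forceValue ij)

          g-below : g k ⪯ forceValue q i k
          g-below with certified k (⊆-false S⊆d dk)
          ... | c , m , threshold , ck , gk⪯m = ⪯-trans gk⪯m (thresholds-below c m threshold ck)

        errVector-above : ∀ F {d q} → ValidFrom G d F → S ⊆ d →
          (∀ {x} → d x ≡ true → Above g x (q x)) → ∀ x → Above g x (errVector q F x)
        errVector-above [] all _ above x = above (all x)
        errVector-above ((i , k) ∷ F) {d} {q} (di , dk , aik , unique , rest) S⊆d above =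
          errVector-above F rest (⊆-trans S⊆d ⊆-insert) above′
          where
          above′ : ∀ {x} → insert k d x ≡ true → Above g x (assign q i k x)
          above′ {x} dx with x ≟ k
          ... | yes refl = forced-above S⊆d (di , dk , aik , unique) above
          ... | no  _    = above dx

      initial-above : ∀ {R} → ValidFrom G S R → ∀ {x} → S x ≡ true →
        Above (errVector (initial S) R) x (initial S x)
      initial-above valid Sx =
        ⪯-reflexive (errVector-coloured (initial S) valid Sx) ,
        λ c m (S⊆c , _) cx → ⊥-elim (not-¬ (S⊆c _ Sx) cx)

      greedy : ∀ L {d} q → S ⊆ d → (∀ x → IsPolynomial (q x)) →
        ∀ F₀ → ValidFrom G d F₀ → length F₀ ≤ L →
        ∃[ R ] (ValidFrom G d R × Certified (errVector q R) d)
      greedy _ q _ _ [] all _ = [] , all , λ x dx → ⊥-elim (not-¬ (all x) dx)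
      greedy (suc L) {d} q S⊆d q-poly ((i , k) ∷ F₀) v₀@(di , dk , aik , unique , _)
             (s≤s |F₀|≤L)
        with cheapest-force q q-poly (di , dk , aik , unique)
      ... | u , v , (du , dv , auv , unique′) , least
        with ValidFrom-shrink v₀ dv
      ... | F₁ , v₁ , |F₁|<|F₀|
        with greedy L (assign q u v) (⊆-trans S⊆d ⊆-insert) (assign-polynomial q-poly u v)
                    F₁ v₁ (≤-trans (s≤s⁻¹ |F₁|<|F₀|) |F₀|≤L)
      ... | R , valid , certified = (u , v) ∷ R , (du , dv , auv , unique′ , valid) , certified′
        where
        chain-vector : PolyVector n
        chain-vector = errVector q ((u , v) ∷ R)

        fixed : ∀ {x} → insert v d x ≡ true → ∀ t → chain-vector x t ≡ assign q u v x t
        fixed = errVector-coloured (assign q u v) valid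

        threshold : Threshold chain-vector d (forceValue q u v)
        threshold = S⊆d , λ i k forces → ⪯-trans (least forces) (forceValue-mono λ j ij →
          let dj = Forces⇒Input⊆ forces j ij in
          ⪯-reflexive λ t → ≡-sym (trans (fixed (⊆-insert {v} {d} j dj) t)
                                          (assign-≢ q u v (≢-by-colour dj dv) t)))

        certified′ : Certified chain-vector d
        certified′ x dx with x ≟ v
        ... | yes refl = d , forceValue q u v , threshold , dx ,
                         ⪯-reflexive λ t → trans (fixed (insert-≡ {x} {d}) t) (assign-≡ q u x t)
        ... | no  x≢v  = certified x (trans (insert-≢ {v} {d} x≢v) dx)

proposition3 : ∀ {n} (G : SimpleGraph n) (S : VSet n) → IsZeroForcingSet G S →
    Σ[ F ∈ List (Force n) ] (ForcingChain G S F × (∀ i → IsErrPolyOfSet G S i (errPoly G S F i)))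
proposition3 G S (F₀ , v₀)
  with greedy G S (length F₀) (initial S) ⊆-refl (initial-polynomial S) F₀ v₀ ≤-refl
... | R , valid , certified =
      R , valid , λ i → (R , valid , λ _ → refl) , λ F valid′ →
        proj₁ (errVector-above G S certified F valid′ ⊆-refl (initial-above G S valid) i)
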